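{- Let $\Delta$ be a finite simplicial complex on $V$ and $\kappa\colon V\to[k]$ a $k$-linear coloring. Let $\Gamma=\Gamma(\Delta,\kappa)=\{S_\kappa: S\in\Delta\}$ and let $\Delta(\Gamma)$ be the simplicial complex constructed from $\Gamma$ as described in the context. Then $\Delta(\Gamma)$ is isomorphic to $\Delta$ as a simplicial complex.
   Context: $[k]=\{1,\dots,k\}$. A multiset on $[k]$ is a function $M\colon[k]\to\mathbb{N}$; $M'\subseteq M$ means $M'(t)\le M(t)$ for all $t$; $\|M\|=\sum_tM(t)$, $(M\cap M')(t)=\min(M(t),M'(t))$. For a face $S$ of $\Delta$, $S_\kappa$ is the multiset with $S_\kappa(t)=|\{v\in S:\kappa(v)=t\}|$. A $k$-linear coloring is a surjective $\kappa\colon V\to[k]$ with $\|F_\kappa\cap F'_\kappa\|=|F\cap F'|$ for all facets (maximal faces) $F,F'$ of $\Delta$. Construction of $\Delta(\Gamma)$ from a collection $\Gamma$ of multisets on $[k]$ closed under submultisets: for $i\in[k]$ put $n_i=\max\{M(i):M\in\Gamma\}$ and $V_i=\{a^i_r:1\le r\le n_i\}$; for $M\in\Gamma$ let $S_M=\{a^i_r: i\in[k],\ 1\le r\le M(i)\}$; $\Delta(\Gamma)$ is the simplicial complex on $\bigcup_iV_i$ generated by the sets $S_M$ for $M$ maximal in $\Gamma$ (its faces are the subsets of such $S_M$). -}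

module Defs where

open import Data.Bool using (Bool; true; false; _∧_; if_then_else_)
open import Data.Nat using (ℕ; zero; suc; _+_; _≤_; _<_; _⊔_; _⊓_)
open import Data.Fin using (Fin; toℕ; _≟_)
open import Data.Product using (Σ; Σ-syntax; ∃; ∃-syntax; _×_; _,_)
open import Data.List using (List; []; _∷_; map; foldr; concatMap)
import Data.Vec.Functional as VF
open import Data.Vec using (tabulate)
import Data.Vec as Vec
open import Relation.Binary.PropositionalEquality using (_≡_)
open import Relation.Nullary.Decidable using (Dec; ⌊_⌋)
open import Function using (_∘_; Surjective)
open import Function.Bundles using (_↔_; Inverse)

SubsetOf : Set → Set
SubsetOf V = V → Bool

_⊆ₛ_ : {V : Set} → SubsetOf V → SubsetOf V → Set
T ⊆ₛ S = ∀ v → T v ≡ true → S v ≡ true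

singleton : {n : ℕ} → Fin n → SubsetOf (Fin n)
singleton v w = ⌊ w ≟ v ⌋

sumFin : (n : ℕ) → (Fin n → ℕ) → ℕ
sumFin n f = Vec.sum (tabulate f)

card : {n : ℕ} → SubsetOf (Fin n) → ℕ
card {n} S = sumFin n (λ v → if S v then 1 else 0)

_∩ₛ_ : {V : Set} → SubsetOf V → SubsetOf V → SubsetOf V
(S ∩ₛ T) v = S v ∧ T v

record SimplicialComplex (V : Set) : Set₁ where
  field
    face : SubsetOf V → Set
    down-closed : ∀ {S T} → T ⊆ₛ S → face S → face T
open SimplicialComplex public

IsOnVertexSet : {n : ℕ} → SimplicialComplex (Fin n) → Set
IsOnVertexSet Δ = ∀ v → face Δ (singleton v)

IsFacet : {V : Set} → SimplicialComplex V → SubsetOf V → Set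
IsFacet Δ F = face Δ F × (∀ G → face Δ G → F ⊆ₛ G → G ⊆ₛ F)

_≅_ : {V W : Set} → SimplicialComplex V → SimplicialComplex W → Set
_≅_ {V} {W} Δ Δ' = Σ (V ↔ W) λ f →
  ∀ (T : SubsetOf W) →
    (face Δ' T → face Δ (T ∘ Inverse.to f)) × (face Δ (T ∘ Inverse.to f) → face Δ' T)

Multiset : ℕ → Set
Multiset k = Fin k → ℕ

_⊆ₘ_ : {k : ℕ} → Multiset k → Multiset k → Set
M' ⊆ₘ M = ∀ t → M' t ≤ M t

‖_‖ : {k : ℕ} → Multiset k → ℕ
‖_‖ {k} M = sumFin k M

_∩ₘ_ : {k : ℕ} → Multiset k → Multiset k → Multiset k
(M ∩ₘ M') t = M t ⊓ M' t

colorMultiset : {n k : ℕ} → (Fin n → Fin k) → SubsetOf (Fin n) → Multiset k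
colorMultiset κ S t = card (λ v → S v ∧ ⌊ κ v ≟ t ⌋)

IsLinearColoring : {n : ℕ} (k : ℕ) → SimplicialComplex (Fin n) → (Fin n → Fin k) → Set
IsLinearColoring k Δ κ =
  Surjective _≡_ _≡_ κ ×
  (∀ F F' → IsFacet Δ F → IsFacet Δ F' →
     ‖ colorMultiset κ F ∩ₘ colorMultiset κ F' ‖ ≡ card (F ∩ₛ F'))

InΓ : {n k : ℕ} → SimplicialComplex (Fin n) → (Fin n → Fin k) → Multiset k → Set
InΓ Δ κ M = ∃[ S ] (face Δ S × (∀ t → colorMultiset κ S t ≡ M t))

MaximalInΓ : {n k : ℕ} → SimplicialComplex (Fin n) → (Fin n → Fin k) → Multiset k → Set
MaximalInΓ Δ κ M = InΓ Δ κ M × (∀ M' → InΓ Δ κ M' → M ⊆ₘ M' → M' ⊆ₘ M)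

allSubsets : (n : ℕ) → List (SubsetOf (Fin n))
allSubsets zero = (λ ()) ∷ []
allSubsets (suc n) = concatMap (λ S → (false VF.∷ S) ∷ (true VF.∷ S) ∷ []) (allSubsets n)

-- n_i = max { M(i) : M ∈ Γ } = max { S_κ(i) : S ∈ Δ }  (0 if Γ is empty)
nΓ : {n k : ℕ} (Δ : SimplicialComplex (Fin n)) → (∀ S → Dec (face Δ S)) →
     (Fin n → Fin k) → Fin k → ℕ
nΓ {n} Δ face? κ i =
  foldr _⊔_ 0 (map (λ S → if ⌊ face? S ⌋ then colorMultiset κ S i else 0) (allSubsets n))

-- vertex set ⋃ V_i of Δ(Γ): a^i_r (1 ≤ r ≤ n_i) is encoded as (i , r-1)
VertΓ : {n k : ℕ} (Δ : SimplicialComplex (Fin n)) → (∀ S → Dec (face Δ S)) →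
        (Fin n → Fin k) → Set
VertΓ {k = k} Δ face? κ = Σ[ i ∈ Fin k ] Fin (nΓ Δ face? κ i)

S[_] : {n k : ℕ} {Δ : SimplicialComplex (Fin n)} {face? : ∀ S → Dec (face Δ S)}
       {κ : Fin n → Fin k} → Multiset k → SubsetOf (VertΓ Δ face? κ)
S[ M ] (i , r) = ⌊ suc (toℕ r) Data.Nat.≤? M i ⌋

⊆ₛ-trans : {V : Set} {A B C : SubsetOf V} → A ⊆ₛ B → B ⊆ₛ C → A ⊆ₛ C
⊆ₛ-trans p q v e = q v (p v e)

ΔΓ : {n k : ℕ} (Δ : SimplicialComplex (Fin n)) (face? : ∀ S → Dec (face Δ S))
     (κ : Fin n → Fin k) → SimplicialComplex (VertΓ Δ face? κ)
ΔΓ Δ face? κ = record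
  { face = λ T → ∃[ M ] (MaximalInΓ Δ κ M × T ⊆ₛ S[_] {Δ = Δ} {face?} {κ} M)
  ; down-closed = λ { T⊆S (M , m , S⊆) → M , m , ⊆ₛ-trans T⊆S S⊆ }
  }

-- For facets F and G, linearity says that the pointwise inequality
-- |(F ∩ G) ∩ κ⁻¹(t)| ≤ min(|F ∩ κ⁻¹(t)|, |G ∩ κ⁻¹(t)|) has equal sums over t, so it is an
-- equality for every color t. Hence the color-t parts of the facets form a chain under
-- inclusion, and on each color class "every facet through v passes through w" is a total
-- preorder. Refining it by vertex index to a linear order and numbering each color class
-- along it, the color-t part of every facet F becomes the initial segment of length
-- |F ∩ κ⁻¹(t)|. Sending a vertex v with number r to a^{κ(v)}_{r+1} is then a bijection
-- (n_i is the size of the color class i) carrying the facets of Δ onto the sets S_{F_κ},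
-- and the F_κ for facets F are exactly the maximal elements of Γ.

module Submission where

open import Defs
open import Data.Bool using (Bool; true; false; _∧_; _∨_; not; if_then_else_)
open import Data.Bool.Properties using (∨-zeroʳ)
import Data.Bool as Bool
open import Data.Nat using (ℕ; zero; suc; _+_; _≤_; _<_; _⊔_; z≤n; s≤s)
import Data.Nat as ℕ
open import Data.Nat.Properties
  using (module ≤-Reasoning; ≤-refl; ≤-trans; ≤-antisym; ≤-reflexive; ≤-total; <-irrefl; <-trans;
         <-cmp; <⇒≢; <⇒≱; ≤⇒≯; +-mono-≤; +-monoˡ-≤; +-monoʳ-≤; +-mono-<-≤; +-mono-≤-<; +-cancelˡ-≤;
         +-cancelʳ-≤; ⊓-glb; m≤n⇒m⊓n≡m; m≤m⊔n; m≤n⊔m; ⊔-lub; ⊔-sel; +-0-commutativeMonoid)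
  renaming (suc-injective to ℕ-suc-injective)
open import Data.Fin using (Fin; toℕ; fromℕ<; _≟_) renaming (zero to fzero; suc to fsuc)
open import Data.Fin.Properties using (toℕ-injective; toℕ-fromℕ<; toℕ<n; suc-injective; any?; all?)
open import Data.Product using (∃; ∃-syntax; _×_; _,_; proj₁; proj₂)
open import Data.Sum using (_⊎_; inj₁; inj₂; [_,_])
open import Data.List using (List; []; _∷_; map; foldr; allFin)
open import Data.List.Membership.Propositional using (_∈_)
open import Data.List.Membership.Propositional.Properties using (∈-allFin)
open import Data.List.Relation.Unary.Any using (Any; here; there)
import Data.List.Relation.Unary.Any as Any
import Data.List.Relation.Unary.Any.Properties as Any
import Data.Vec.Functional as VF
open import Data.Vec.Properties using (tabulate-cong)
import Data.Vec as Vec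
open import Function using (_∘_; id; case_of_)
open import Function.Bundles using (_↔_; mk↔ₛ′)
open import Relation.Binary.PropositionalEquality
  using (_≡_; _≢_; refl; sym; trans; cong; subst; subst₂; module ≡-Reasoning)
open import Relation.Binary using (tri<; tri≈; tri>)
open import Relation.Nullary using (¬_; Dec; yes; no; contradiction)
open import Data.Empty using (⊥-elim)
open import Relation.Nullary.Decidable
  using (⌊_⌋; isYes≗does; dec-true; dec-false; _×-dec_; _⊎-dec_; ¬?; map′)
open import Algebra.Properties.CommutativeMonoid.Sum +-0-commutativeMonoid using (sum; ∑-comm)

private variable
  n k m : ℕ

toWitness≡ : {A : Set} (a? : Dec A) → ⌊ a? ⌋ ≡ true → A
toWitness≡ (yes a) _ = a

fromWitness≡ : {A : Set} (a? : Dec A) → A → ⌊ a? ⌋ ≡ true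
fromWitness≡ a? a = trans (isYes≗does a?) (dec-true a? a)

fromWitnessFalse≡ : {A : Set} (a? : Dec A) → ¬ A → ⌊ a? ⌋ ≡ false
fromWitnessFalse≡ a? ¬a = trans (isYes≗does a?) (dec-false a? ¬a)

⌊⌋-cong : {A B : Set} (a? : Dec A) (b? : Dec B) → (A → B) → (B → A) → ⌊ a? ⌋ ≡ ⌊ b? ⌋
⌊⌋-cong (yes a)  b? A⇒B _   = sym (fromWitness≡ b? (A⇒B a))
⌊⌋-cong (no ¬a) b? _   B⇒A = sym (fromWitnessFalse≡ b? (¬a ∘ B⇒A))

true≢false : true ≢ false
true≢false ()

∧-true : {a b : Bool} → a ≡ true → b ≡ true → a ∧ b ≡ true
∧-true refl refl = refl

∧-trueˡ : {a b : Bool} → a ∧ b ≡ true → a ≡ true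
∧-trueˡ {true} _ = refl

∧-trueʳ : {a b : Bool} → a ∧ b ≡ true → b ≡ true
∧-trueʳ {true} b≡true = b≡true

indicator : Bool → ℕ
indicator b = if b then 1 else 0

sumFin-cong : {f g : Fin k → ℕ} → (∀ t → f t ≡ g t) → sumFin k f ≡ sumFin k g
sumFin-cong f≗g = cong Vec.sum (tabulate-cong f≗g)

sumFin-mono : {f g : Fin k → ℕ} → (∀ t → f t ≤ g t) → sumFin k f ≤ sumFin k g
sumFin-mono {zero}  _   = z≤n
sumFin-mono {suc k} f≤g = +-mono-≤ (f≤g fzero) (sumFin-mono (f≤g ∘ fsuc))

sumFin-mono-< : {f g : Fin k → ℕ} (x : Fin k) → (∀ t → f t ≤ g t) → f x < g x → sumFin k f < sumFin k g
sumFin-mono-< fzero    f≤g fx<gx = +-mono-<-≤ fx<gx (sumFin-mono (f≤g ∘ fsuc))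
sumFin-mono-< (fsuc x) f≤g fx<gx = +-mono-≤-< (f≤g fzero) (sumFin-mono-< x (f≤g ∘ fsuc) fx<gx)

sumFin-≤⇒pointwise-≡ : {f g : Fin k → ℕ} → (∀ t → f t ≤ g t) → sumFin k g ≤ sumFin k f →
                       ∀ t → f t ≡ g t
sumFin-≤⇒pointwise-≡ {suc k} {f} {g} f≤g Σg≤Σf = pointwise
  where
  Σf′ = sumFin k (f ∘ fsuc)
  Σg′ = sumFin k (g ∘ fsuc)
  Σf′≤Σg′ : Σf′ ≤ Σg′
  Σf′≤Σg′ = sumFin-mono (f≤g ∘ fsuc)
  g₀≤f₀ : g fzero ≤ f fzero
  g₀≤f₀ = +-cancelʳ-≤ Σg′ (g fzero) (f fzero) (≤-trans Σg≤Σf (+-monoʳ-≤ (f fzero) Σf′≤Σg′))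
  Σg′≤Σf′ : Σg′ ≤ Σf′
  Σg′≤Σf′ = +-cancelˡ-≤ (g fzero) Σg′ Σf′ (≤-trans Σg≤Σf (+-monoˡ-≤ Σf′ (f≤g fzero)))
  pointwise : ∀ t → f t ≡ g t
  pointwise fzero    = ≤-antisym (f≤g fzero) g₀≤f₀
  pointwise (fsuc t) = sumFin-≤⇒pointwise-≡ (f≤g ∘ fsuc) Σg′≤Σf′ t

sumFin≡sum : (f : Fin k → ℕ) → sumFin k f ≡ sum f
sumFin≡sum {zero}  f = refl
sumFin≡sum {suc k} f = cong (f fzero +_) (sumFin≡sum (f ∘ fsuc))

sumFin-comm : (f : Fin n → Fin k → ℕ) →
              sumFin n (λ v → sumFin k (f v)) ≡ sumFin k (λ t → sumFin n (λ v → f v t))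
sumFin-comm {n} {k} f = begin
  sumFin n (λ v → sumFin k (f v))    ≡⟨ sumFin-cong (λ v → sumFin≡sum (f v)) ⟩
  sumFin n (λ v → sum (f v))         ≡⟨ sumFin≡sum (λ v → sum (f v)) ⟩
  sum (λ v → sum (f v))              ≡⟨ ∑-comm f ⟩
  sum (λ t → sum (λ v → f v t))      ≡⟨ sumFin≡sum (λ t → sum (λ v → f v t)) ⟨
  sumFin k (λ t → sum (λ v → f v t)) ≡⟨ sumFin-cong (λ t → sumFin≡sum (λ v → f v t)) ⟨
  sumFin k (λ t → sumFin n (λ v → f v t)) ∎
  where open ≡-Reasoning

infix 4 _≐_

_≐_ : {V : Set} → SubsetOf V → SubsetOf V → Set
S ≐ T = ∀ v → S v ≡ T v

∩-⊆ˡ : {V : Set} {S T : SubsetOf V} → (S ∩ₛ T) ⊆ₛ S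
∩-⊆ˡ _ = ∧-trueˡ

∩-⊆ʳ : {V : Set} {S T : SubsetOf V} → (S ∩ₛ T) ⊆ₛ T
∩-⊆ʳ {S = S} v = ∧-trueʳ {S v}

∩-monoˡ : {V : Set} {S S′ T : SubsetOf V} → S ⊆ₛ S′ → (S ∩ₛ T) ⊆ₛ (S′ ∩ₛ T)
∩-monoˡ {S = S} S⊆S′ v v∈ = ∧-true (S⊆S′ v (∧-trueˡ v∈)) (∧-trueʳ {S v} v∈)

card-cong : {A B : SubsetOf (Fin n)} → (∀ v → A v ≡ B v) → card A ≡ card B
card-cong A≗B = sumFin-cong (cong indicator ∘ A≗B)

card-empty : {A : SubsetOf (Fin n)} → (∀ v → A v ≡ false) → card A ≡ 0
card-empty {zero}  _   = refl
card-empty {suc n} A≗∅ rewrite A≗∅ fzero = card-empty (A≗∅ ∘ fsuc)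

card-full : ∀ n → card {n} (λ _ → true) ≡ n
card-full zero    = refl
card-full (suc n) = cong suc (card-full n)

indicator-mono : {a b : Bool} → (a ≡ true → b ≡ true) → indicator a ≤ indicator b
indicator-mono {false} _   = z≤n
indicator-mono {true}  a⇒b rewrite a⇒b refl = ≤-refl

card-mono : {A B : SubsetOf (Fin n)} → A ⊆ₛ B → card A ≤ card B
card-mono A⊆B = sumFin-mono (λ v → indicator-mono (A⊆B v))

card-mono-< : {A B : SubsetOf (Fin n)} (x : Fin n) → A ⊆ₛ B → B x ≡ true → A x ≡ false → card A < card B
card-mono-< {A = A} {B} x A⊆B Bx Ax = sumFin-mono-< x (λ v → indicator-mono (A⊆B v)) x∈B∖A
  where
  x∈B∖A : indicator (A x) < indicator (B x)
  x∈B∖A rewrite Ax | Bx = s≤s z≤n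

card-∋⇒positive : {A : SubsetOf (Fin n)} (x : Fin n) → A x ≡ true → 0 < card A
card-∋⇒positive {n} {A} x Ax =
  subst (_< card A) (card-empty {n} (λ _ → refl)) (card-mono-< {A = λ _ → false} {A} x (λ _ ()) Ax refl)

card-≤⇒⊇ : {A B : SubsetOf (Fin n)} → A ⊆ₛ B → card B ≤ card A → B ⊆ₛ A
card-≤⇒⊇ {A = A} A⊆B |B|≤|A| v Bv with A v in Av
... | true  = refl
... | false = contradiction |B|≤|A| (<⇒≱ (card-mono-< v A⊆B Bv Av))

sumFin-indicator-≟ : ∀ {x} → x < m → sumFin m (λ s → indicator ⌊ x ℕ.≟ toℕ s ⌋) ≡ 1
sumFin-indicator-≟ {suc m} {zero}  _         = cong suc (card-empty {m} (λ _ → refl))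
sumFin-indicator-≟ {suc m} {suc x} (s≤s x<m) =
  trans (sumFin-cong {m} ≟-suc) (sumFin-indicator-≟ {m} {x} x<m)
  where
  ≟-suc : ∀ s → indicator ⌊ suc x ℕ.≟ suc (toℕ s) ⌋ ≡ indicator ⌊ x ℕ.≟ toℕ s ⌋
  ≟-suc s = cong indicator (⌊⌋-cong (suc x ℕ.≟ suc (toℕ s)) (x ℕ.≟ toℕ s) ℕ-suc-injective (cong suc))

card-partition : (A : SubsetOf (Fin n)) (f : Fin n → ℕ) → (∀ v → A v ≡ true → f v < m) →
                 card A ≡ sumFin m (λ s → card (λ v → A v ∧ ⌊ f v ℕ.≟ toℕ s ⌋))
card-partition {n} {m} A f bound =
  trans (sumFin-cong {n} split) (sumFin-comm {n} {m} (λ v s → indicator (A v ∧ ⌊ f v ℕ.≟ toℕ s ⌋)))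
  where
  split : ∀ v → indicator (A v) ≡ sumFin m (λ s → indicator (A v ∧ ⌊ f v ℕ.≟ toℕ s ⌋))
  split v with A v in Av
  ... | true  = sym (sumFin-indicator-≟ (bound v Av))
  ... | false = sym (card-empty {m} (λ _ → refl))

card-subsingleton : {A : SubsetOf (Fin n)} → (∀ v w → A v ≡ true → A w ≡ true → v ≡ w) → card A ≤ 1
card-subsingleton {zero}      _       = z≤n
card-subsingleton {suc n} {A} A-unique with A fzero in A0
... | true  = s≤s (≤-reflexive (card-empty rest-empty))
  where
  rest-empty : ∀ v → A (fsuc v) ≡ false
  rest-empty v with A (fsuc v) in Av
  ... | true  = case A-unique (fsuc v) fzero Av A0 of λ ()
  ... | false = refl
... | false = card-subsingleton (λ v w Av Aw → suc-injective (A-unique (fsuc v) (fsuc w) Av Aw))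

card-≤-indicator : {A : SubsetOf (Fin n)} {b : Bool} → (∀ v w → A v ≡ true → A w ≡ true → v ≡ w) →
                   (∀ v → A v ≡ true → b ≡ true) → card A ≤ indicator b
card-≤-indicator {b = true}      A-unique _   = card-subsingleton A-unique
card-≤-indicator {A = A} {false} _        A⇒b = ≤-reflexive (card-empty A-empty)
  where
  A-empty : ∀ v → A v ≡ false
  A-empty v with A v in Av
  ... | true  = case A⇒b v Av of λ ()
  ... | false = refl

card-injection : {A : SubsetOf (Fin n)} (f : Fin n → ℕ) (B : ℕ → Bool) →
                 (∀ v w → A v ≡ true → A w ≡ true → f v ≡ f w → v ≡ w) →
                 (∀ v → A v ≡ true → f v < m) → (∀ v → A v ≡ true → B (f v) ≡ true) →
                 card A ≤ card {m} (B ∘ toℕ)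
card-injection {n} {m} {A} f B f-injective bound f∈B = begin
  card A                          ≡⟨ card-partition A f bound ⟩
  sumFin m (λ s → card (fibre s)) ≤⟨ sumFin-mono {m} fibre≤ ⟩
  card {m} (B ∘ toℕ)              ∎
  where
  open ≤-Reasoning
  fibre : Fin m → SubsetOf (Fin n)
  fibre s v = A v ∧ ⌊ f v ℕ.≟ toℕ s ⌋
  fibre≤ : ∀ s → card (fibre s) ≤ indicator (B (toℕ s))
  fibre≤ s = card-≤-indicator {A = fibre s}
    (λ v w v∈ w∈ → f-injective v w (∧-trueˡ v∈) (∧-trueˡ w∈) (trans (f≡s v v∈) (sym (f≡s w w∈))))
    (λ v v∈ → subst (λ x → B x ≡ true) (f≡s v v∈) (f∈B v (∧-trueˡ v∈)))
    where
    f≡s : ∀ v → fibre s v ≡ true → f v ≡ toℕ s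
    f≡s v v∈ = toWitness≡ (f v ℕ.≟ toℕ s) (∧-trueʳ {A v} v∈)

injective⇒onto : {A : SubsetOf (Fin n)} (f : Fin n → ℕ) →
                 (∀ v w → A v ≡ true → A w ≡ true → f v ≡ f w → v ≡ w) →
                 (∀ v → A v ≡ true → f v < m) → m ≤ card A →
                 ∀ {r} → r < m → ∃[ v ] A v ≡ true × f v ≡ r
injective⇒onto {n} {m} {A} f f-injective bound m≤|A| {r} r<m
  with any? (λ v → (A v Bool.≟ true) ×-dec (f v ℕ.≟ r))
... | yes hit  = hit
... | no  ¬hit = contradiction m≤|A| (<⇒≱ |A|<m)
  where
  open ≤-Reasoning
  B : ℕ → Bool
  B x = not ⌊ x ℕ.≟ r ⌋
  r∉B : B (toℕ (fromℕ< r<m)) ≡ false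
  r∉B = cong not (fromWitness≡ (toℕ (fromℕ< r<m) ℕ.≟ r) (toℕ-fromℕ< r<m))
  r-missed : ∀ v → A v ≡ true → B (f v) ≡ true
  r-missed v Av = cong not (fromWitnessFalse≡ (f v ℕ.≟ r) (λ fv≡r → ¬hit (v , Av , fv≡r)))
  |A|<m : card A < m
  |A|<m = begin-strict
    card A                               ≤⟨ card-injection f B f-injective bound r-missed ⟩
    card {m} (B ∘ toℕ)                   <⟨ card-mono-< (fromℕ< r<m) (λ _ _ → refl) refl r∉B ⟩
    card {m} (λ _ → true)                ≡⟨ card-full m ⟩
    m                                    ∎

allSubsets-complete : ∀ n (S : SubsetOf (Fin n)) → Any (_≐ S) (allSubsets n)
allSubsets-complete zero    S = here (λ ())
allSubsets-complete (suc n) S = Any.concatMap⁺ _ (Any.map with-head (allSubsets-complete n (S ∘ fsuc)))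
  where
  with-head : ∀ {T} → T ≐ S ∘ fsuc → Any (_≐ S) ((false VF.∷ T) ∷ (true VF.∷ T) ∷ [])
  with-head T≐S with S fzero in S0
  ... | false = here λ { fzero → sym S0 ; (fsuc v) → T≐S v }
  ... | true  = there (here λ { fzero → sym S0 ; (fsuc v) → T≐S v })

∃-subset? : {P : SubsetOf (Fin n) → Set} → (∀ {S T} → S ≐ T → P S → P T) →
            (∀ S → Dec (P S)) → Dec (∃ P)
∃-subset? {n} P-resp P? with Any.any? P? (allSubsets n)
... | yes P-listed = yes (Any.satisfied P-listed)
... | no  ¬listed  = no λ (S , PS) →
  ¬listed (Any.map (λ T≐S → P-resp (λ v → sym (T≐S v)) PS) (allSubsets-complete n S))

maximum : {A : Set} → (A → ℕ) → List A → ℕ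
maximum h xs = foldr _⊔_ 0 (map h xs)

≤-maximum : {A : Set} {h : A → ℕ} {a : ℕ} (xs : List A) → Any (λ x → a ≤ h x) xs → a ≤ maximum h xs
≤-maximum {h = h} (x ∷ xs) (here a≤hx)  = ≤-trans a≤hx (m≤m⊔n (h x) _)
≤-maximum {h = h} (x ∷ xs) (there a≤xs) = ≤-trans (≤-maximum xs a≤xs) (m≤n⊔m (h x) _)

maximum-lub : {A : Set} {h : A → ℕ} {c : ℕ} (xs : List A) → (∀ x → h x ≤ c) → maximum h xs ≤ c
maximum-lub []       _    = z≤n
maximum-lub (x ∷ xs) h≤c = ⊔-lub (h≤c x) (maximum-lub xs h≤c)

maximum-attained : {A : Set} {h : A → ℕ} (xs : List A) → 0 < maximum h xs → ∃[ x ] h x ≡ maximum h xs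
maximum-attained {h = h} (x ∷ xs) 0<max with ⊔-sel (h x) (maximum h xs)
... | inj₁ max≡hx = x , sym max≡hx
... | inj₂ max≡rest with maximum-attained xs (subst (0 <_) max≡rest 0<max)
...   | y , hy≡rest = y , trans hy≡rest (sym max≡rest)

module Facets {n : ℕ} (Δ : SimplicialComplex (Fin n)) (face? : ∀ S → Dec (face Δ S)) where

  face-resp-≐ : {S T : SubsetOf (Fin n)} → S ≐ T → face Δ S → face Δ T
  face-resp-≐ S≐T = down-closed Δ (λ v Tv → trans (S≐T v) Tv)

  facet-resp-≐ : {S T : SubsetOf (Fin n)} → S ≐ T → IsFacet Δ S → IsFacet Δ T
  facet-resp-≐ {S} {T} S≐T (S-face , S-max) = face-resp-≐ S≐T S-face , T-max
    where
    T-max : ∀ G → face Δ G → T ⊆ₛ G → G ⊆ₛ T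
    T-max G G-face T⊆G v Gv =
      trans (sym (S≐T v)) (S-max G G-face (λ w Sw → T⊆G w (trans (sym (S≐T w)) Sw)) v Gv)

  insert : Fin n → SubsetOf (Fin n) → SubsetOf (Fin n)
  insert u S w = S w ∨ ⌊ w ≟ u ⌋

  ⊆-insert : ∀ {u S} → S ⊆ₛ insert u S
  ⊆-insert v Sv rewrite Sv = refl

  ∈-insert : ∀ {u} S → insert u S u ≡ true
  ∈-insert {u} S rewrite fromWitness≡ (u ≟ u) refl = ∨-zeroʳ (S u)

  insert-⊆ : ∀ {u S G} → S ⊆ₛ G → G u ≡ true → insert u S ⊆ₛ G
  insert-⊆ {u} {S} {G} S⊆G Gu w w∈ with S w in Sw
  ... | true  = S⊆G w Sw
  ... | false = subst (λ x → G x ≡ true) (sym (toWitness≡ (w ≟ u) w∈)) Gu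

  extend : SubsetOf (Fin n) → List (Fin n) → SubsetOf (Fin n)
  extend S []       = S
  extend S (u ∷ us) with face? (insert u S)
  ... | yes _ = extend (insert u S) us
  ... | no  _ = extend S us

  extend-face : ∀ {S} us → face Δ S → face Δ (extend S us)
  extend-face         []       S-face = S-face
  extend-face {S} (u ∷ us) S-face with face? (insert u S)
  ... | yes S+u-face = extend-face us S+u-face
  ... | no  _        = extend-face us S-face

  ⊆-extend : ∀ {S} us → S ⊆ₛ extend S us
  ⊆-extend         []       v Sv = Sv
  ⊆-extend {S} (u ∷ us) v Sv with face? (insert u S)
  ... | yes _ = ⊆-extend us v (⊆-insert {u} {S} v Sv)
  ... | no  _ = ⊆-extend us v Sv

  extend-maximal : ∀ {S G} us → face Δ G → extend S us ⊆ₛ G →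
                   ∀ {v} → v ∈ us → G v ≡ true → extend S us v ≡ true
  extend-maximal {S} {G} (u ∷ us) G-face ext⊆G (there v∈us) Gv with face? (insert u S)
  ... | yes _ = extend-maximal us G-face ext⊆G v∈us Gv
  ... | no  _ = extend-maximal us G-face ext⊆G v∈us Gv
  extend-maximal {S} {G} (u ∷ us) G-face ext⊆G (here refl) Gu with face? (insert u S)
  ... | yes _          = ⊆-extend us u (∈-insert S)
  ... | no  ¬S+u-face =
    contradiction (down-closed Δ (insert-⊆ (λ w Sw → ext⊆G w (⊆-extend us w Sw)) Gu) G-face) ¬S+u-face

  extendToFacet : ∀ {S} → face Δ S → ∃[ F ] IsFacet Δ F × S ⊆ₛ F
  extendToFacet {S} S-face =
    extend S (allFin n) ,
    (extend-face (allFin n) S-face ,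
     λ G G-face ext⊆G v Gv → extend-maximal (allFin n) G-face ext⊆G (∈-allFin v) Gv) ,
    ⊆-extend (allFin n)

  isFacet? : ∀ S → Dec (IsFacet Δ S)
  isFacet? S = map′ saturated⇒facet facet⇒saturated
                 (face? S ×-dec all? (λ v → (S v Bool.≟ true) ⊎-dec ¬? (face? (insert v S))))
    where
    Saturated : Set
    Saturated = ∀ v → S v ≡ true ⊎ ¬ face Δ (insert v S)
    saturated⇒facet : face Δ S × Saturated → IsFacet Δ S
    saturated⇒facet (S-face , saturated) = S-face , λ G G-face S⊆G v Gv →
      [ id , contradiction (down-closed Δ (insert-⊆ S⊆G Gv) G-face) ] (saturated v)
    facet⇒saturated : IsFacet Δ S → face Δ S × Saturated
    facet⇒saturated (S-face , S-max) = S-face , saturated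
      where
      saturated : Saturated
      saturated v with S v in Sv
      ... | true  = inj₁ refl
      ... | false = inj₂ λ S+v-face →
        case trans (sym (S-max (insert v S) S+v-face (⊆-insert {v} {S}) v (∈-insert S))) Sv of λ ()

  infix 4 _≼_ _≼?_

  _≼_ : Fin n → Fin n → Set
  w ≼ v = ∀ F → IsFacet Δ F → F v ≡ true → F w ≡ true

  ≼-refl : ∀ {v} → v ≼ v
  ≼-refl _ _ Fv = Fv

  ≼-trans : ∀ {u w v} → u ≼ w → w ≼ v → u ≼ v
  ≼-trans u≼w w≼v F F-facet = u≼w F F-facet ∘ w≼v F F-facet

  Separated : Fin n → Fin n → Set
  Separated w v = ∃[ F ] IsFacet Δ F × F v ≡ true × F w ≡ false

  separated? : ∀ w v → Dec (Separated w v)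
  separated? w v = ∃-subset?
    (λ S≐T (S-facet , Sv , Sw) → facet-resp-≐ S≐T S-facet , trans (sym (S≐T v)) Sv , trans (sym (S≐T w)) Sw)
    (λ F → isFacet? F ×-dec (F v Bool.≟ true) ×-dec (F w Bool.≟ false))

  ¬separated⇒≼ : ∀ {w v} → ¬ Separated w v → w ≼ v
  ¬separated⇒≼ {w} ¬separated F F-facet Fv with F w in Fw
  ... | true  = refl
  ... | false = contradiction (F , F-facet , Fv , Fw) ¬separated

  ≼⇒¬separated : ∀ {w v} → w ≼ v → ¬ Separated w v
  ≼⇒¬separated w≼v (F , F-facet , Fv , Fw) = case trans (sym (w≼v F F-facet Fv)) Fw of λ ()

  _≼?_ : ∀ w v → Dec (w ≼ v)
  w ≼? v = map′ ¬separated⇒≼ ≼⇒¬separated (¬? (separated? w v))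

  ⋠⇒separated : ∀ {w v} → ¬ w ≼ v → Separated w v
  ⋠⇒separated {w} {v} w⋠v with separated? w v
  ... | yes separated = separated
  ... | no  ¬separated = contradiction (¬separated⇒≼ ¬separated) w⋠v

module LinearColoring {n k : ℕ} (Δ : SimplicialComplex (Fin n)) (face? : ∀ S → Dec (face Δ S))
                       (singletons-are-faces : IsOnVertexSet Δ)
                       (κ : Fin n → Fin k) (κ-linear : IsLinearColoring k Δ κ) where

  open Facets Δ face?

  κ⁻¹ : Fin k → SubsetOf (Fin n)
  κ⁻¹ t v = ⌊ κ v ≟ t ⌋

  classSize : Fin k → ℕ
  classSize t = card (κ⁻¹ t)

  ∈κ⁻¹ : ∀ v → κ⁻¹ (κ v) v ≡ true
  ∈κ⁻¹ v = fromWitness≡ (κ v ≟ κ v) refl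

  colorMultiset-mono : ∀ {S T} → S ⊆ₛ T → colorMultiset κ S ⊆ₘ colorMultiset κ T
  colorMultiset-mono S⊆T t = card-mono (∩-monoˡ S⊆T)

  ‖colorMultiset‖ : ∀ S → ‖ colorMultiset κ S ‖ ≡ card S
  ‖colorMultiset‖ S = sym (trans (card-partition S (toℕ ∘ κ) (λ v _ → toℕ<n (κ v)))
                                 (sumFin-cong {k} (λ t → card-cong (λ v → cong (S v ∧_) (≟-toℕ v t)))))
    where
    ≟-toℕ : ∀ v t → ⌊ toℕ (κ v) ℕ.≟ toℕ t ⌋ ≡ ⌊ κ v ≟ t ⌋
    ≟-toℕ v t = ⌊⌋-cong (toℕ (κ v) ℕ.≟ toℕ t) (κ v ≟ t) toℕ-injective (cong toℕ)

  colorMultiset-facet-∩ : ∀ {F G} → IsFacet Δ F → IsFacet Δ G →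
                          ∀ t → colorMultiset κ (F ∩ₛ G) t ≡ (colorMultiset κ F ∩ₘ colorMultiset κ G) t
  colorMultiset-facet-∩ {F} {G} F-facet G-facet = sumFin-≤⇒pointwise-≡
    (λ t → ⊓-glb (colorMultiset-mono ∩-⊆ˡ t) (colorMultiset-mono (∩-⊆ʳ {S = F}) t))
    (≤-reflexive (trans (proj₂ κ-linear F G F-facet G-facet) (sym (‖colorMultiset‖ (F ∩ₛ G)))))

  facet-chain : ∀ {F G v} → IsFacet Δ F → IsFacet Δ G →
                colorMultiset κ F (κ v) ≤ colorMultiset κ G (κ v) → F v ≡ true → G v ≡ true
  facet-chain {F} {G} {v} F-facet G-facet Fκv≤Gκv Fv =
    ∧-trueʳ {F v} (∧-trueˡ (F∩κ⁻¹⊆F∩G∩κ⁻¹ v (∧-true Fv (∈κ⁻¹ v))))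
    where
    Fκv≤F∩Gκv : colorMultiset κ F (κ v) ≤ colorMultiset κ (F ∩ₛ G) (κ v)
    Fκv≤F∩Gκv = ≤-reflexive (begin
      colorMultiset κ F (κ v)                        ≡⟨ m≤n⇒m⊓n≡m Fκv≤Gκv ⟨
      (colorMultiset κ F ∩ₘ colorMultiset κ G) (κ v) ≡⟨ colorMultiset-facet-∩ F-facet G-facet (κ v) ⟨
      colorMultiset κ (F ∩ₛ G) (κ v)                 ∎)
      where open ≡-Reasoning
    F∩κ⁻¹⊆F∩G∩κ⁻¹ : (F ∩ₛ κ⁻¹ (κ v)) ⊆ₛ ((F ∩ₛ G) ∩ₛ κ⁻¹ (κ v))
    F∩κ⁻¹⊆F∩G∩κ⁻¹ = card-≤⇒⊇ (∩-monoˡ (∩-⊆ˡ {S = F} {G})) Fκv≤F∩Gκv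

  vertex-in-facet : ∀ v → ∃[ F ] IsFacet Δ F × F v ≡ true
  vertex-in-facet v with extendToFacet (singletons-are-faces v)
  ... | F , F-facet , v⊆F = F , F-facet , v⊆F v (fromWitness≡ (v ≟ v) refl)

  ≼-total : ∀ {w v} → κ w ≡ κ v → w ≼ v ⊎ v ≼ w
  ≼-total {w} {v} κw≡κv with w ≼? v | v ≼? w
  ... | yes w≼v | _       = inj₁ w≼v
  ... | no  _   | yes v≼w = inj₂ v≼w
  ... | no  w⋠v | no  v⋠w with ⋠⇒separated w⋠v | ⋠⇒separated v⋠w
  ...   | F , F-facet , Fv , Fw | G , G-facet , Gw , Gv
          with ≤-total (colorMultiset κ F (κ v)) (colorMultiset κ G (κ v))
  ...     | inj₁ Fκv≤Gκv = contradiction (trans (sym (facet-chain F-facet G-facet Fκv≤Gκv Fv)) Gv) true≢false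
  ...     | inj₂ Gκv≤Fκv = contradiction (trans (sym (facet-chain G-facet F-facet Gκw≤Fκw Gw)) Fw) true≢false
    where
    Gκw≤Fκw : colorMultiset κ G (κ w) ≤ colorMultiset κ F (κ w)
    Gκw≤Fκw = subst (λ t → colorMultiset κ G t ≤ colorMultiset κ F t) (sym κw≡κv) Gκv≤Fκv

  infix 4 _◁_ _◁?_

  -- Ties of ≼ (vertices lying in exactly the same facets) are broken by index.
  _◁_ : Fin n → Fin n → Set
  w ◁ v = κ w ≡ κ v × w ≼ v × (¬ v ≼ w ⊎ toℕ w < toℕ v)

  _◁?_ : ∀ w v → Dec (w ◁ v)
  w ◁? v = (κ w ≟ κ v) ×-dec (w ≼? v) ×-dec (¬? (v ≼? w) ⊎-dec (toℕ w ℕ.<? toℕ v))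

  ◁-irrefl : ∀ {v} → ¬ v ◁ v
  ◁-irrefl (_ , _ , inj₁ v⋠v) = v⋠v ≼-refl
  ◁-irrefl (_ , _ , inj₂ v<v) = <-irrefl refl v<v

  ◁-trans : ∀ {u w v} → u ◁ w → w ◁ v → u ◁ v
  ◁-trans {u} {w} {v} (κu≡κw , u≼w , u-before-w) (κw≡κv , w≼v , w-before-v) =
    trans κu≡κw κw≡κv , ≼-trans u≼w w≼v , u-before-v u-before-w w-before-v
    where
    u-before-v : ¬ w ≼ u ⊎ toℕ u < toℕ w → ¬ v ≼ w ⊎ toℕ w < toℕ v → ¬ v ≼ u ⊎ toℕ u < toℕ v
    u-before-v (inj₁ w⋠u) _           = inj₁ λ v≼u → w⋠u (≼-trans w≼v v≼u)
    u-before-v _           (inj₁ v⋠w) = inj₁ λ v≼u → v⋠w (≼-trans v≼u u≼w)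
    u-before-v (inj₂ u<w) (inj₂ w<v)  = inj₂ (<-trans u<w w<v)

  ◁-total : ∀ {w v} → κ w ≡ κ v → w ≢ v → w ◁ v ⊎ v ◁ w
  ◁-total {w} {v} κw≡κv w≢v with w ≼? v | v ≼? w
  ... | yes w≼v | no  v⋠w = inj₁ (κw≡κv , w≼v , inj₁ v⋠w)
  ... | no  w⋠v | yes v≼w = inj₂ (sym κw≡κv , v≼w , inj₁ w⋠v)
  ... | no  w⋠v | no  v⋠w = ⊥-elim ([ w⋠v , v⋠w ] (≼-total κw≡κv))
  ... | yes w≼v | yes v≼w with <-cmp (toℕ w) (toℕ v)
  ...   | tri< w<v _    _   = inj₁ (κw≡κv , w≼v , inj₂ w<v)
  ...   | tri≈ _   w≡v _   = contradiction (toℕ-injective w≡v) w≢v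
  ...   | tri> _   _    v<w = inj₂ (sym κw≡κv , v≼w , inj₂ v<w)

  -- The vertex v of Δ corresponds to the vertex a^{κ v}_{pos v + 1} of Δ(Γ).
  pos : Fin n → ℕ
  pos v = card (λ w → ⌊ w ◁? v ⌋)

  v⋪v : ∀ v → ⌊ v ◁? v ⌋ ≡ false
  v⋪v v = fromWitnessFalse≡ (v ◁? v) ◁-irrefl

  pos-< : ∀ {w v} → w ◁ v → pos w < pos v
  pos-< {w} {v} w◁v = card-mono-< w
    (λ u u◁w → fromWitness≡ (u ◁? v) (◁-trans (toWitness≡ (u ◁? w) u◁w) w◁v))
    (fromWitness≡ (w ◁? v) w◁v) (v⋪v w)

  pos-injective : ∀ {w v} → κ w ≡ κ v → pos w ≡ pos v → w ≡ v
  pos-injective {w} {v} κw≡κv pos-w≡pos-v with w ≟ v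
  ... | yes w≡v = w≡v
  ... | no  w≢v with ◁-total κw≡κv w≢v
  ...   | inj₁ w◁v = contradiction pos-w≡pos-v (<⇒≢ (pos-< w◁v))
  ...   | inj₂ v◁w = contradiction (sym pos-w≡pos-v) (<⇒≢ (pos-< v◁w))

  pos<classSize : ∀ v → pos v < classSize (κ v)
  pos<classSize v = card-mono-< v
    (λ w w◁v → fromWitness≡ (κ w ≟ κ v) (proj₁ (toWitness≡ (w ◁? v) w◁v))) (∈κ⁻¹ v) (v⋪v v)

  ∈facet⇒pos< : ∀ {F v} → IsFacet Δ F → F v ≡ true → pos v < colorMultiset κ F (κ v)
  ∈facet⇒pos< {F} {v} F-facet Fv = card-mono-< v ◁v⊆F∩κ⁻¹ (∧-true Fv (∈κ⁻¹ v)) (v⋪v v)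
    where
    ◁v⊆F∩κ⁻¹ : (λ w → ⌊ w ◁? v ⌋) ⊆ₛ (F ∩ₛ κ⁻¹ (κ v))
    ◁v⊆F∩κ⁻¹ w w◁v with toWitness≡ (w ◁? v) w◁v
    ... | κw≡κv , w≼v , _ = ∧-true (w≼v F F-facet Fv) (fromWitness≡ (κ w ≟ κ v) κw≡κv)

  pos<⇒∈facet : ∀ {F v} → IsFacet Δ F → pos v < colorMultiset κ F (κ v) → F v ≡ true
  pos<⇒∈facet {F} {v} F-facet pos<Fκv with F v in Fv
  ... | true  = refl
  ... | false = contradiction pos<Fκv (≤⇒≯ (card-mono F∩κ⁻¹⊆◁v))
    where
    F∩κ⁻¹⊆◁v : (F ∩ₛ κ⁻¹ (κ v)) ⊆ₛ (λ w → ⌊ w ◁? v ⌋)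
    F∩κ⁻¹⊆◁v w w∈ = fromWitness≡ (w ◁? v) (κw≡κv , w≼v , inj₁ v⋠w)
      where
      Fw : F w ≡ true
      Fw = ∧-trueˡ w∈
      κw≡κv : κ w ≡ κ v
      κw≡κv = toWitness≡ (κ w ≟ κ v) (∧-trueʳ {F w} w∈)
      v⋠w : ¬ v ≼ w
      v⋠w v≼w = true≢false (trans (sym (v≼w F F-facet Fw)) Fv)
      w≼v : w ≼ v
      w≼v G G-facet Gv with ≤-total (colorMultiset κ F (κ v)) (colorMultiset κ G (κ v))
      ... | inj₁ Fκv≤Gκv = facet-chain F-facet G-facet
                              (subst (λ t → colorMultiset κ F t ≤ colorMultiset κ G t) (sym κw≡κv) Fκv≤Gκv) Fw
      ... | inj₂ Gκv≤Fκv = contradiction (trans (sym (facet-chain G-facet F-facet Gκv≤Fκv Gv)) Fv) true≢false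

  facet⇒maximal : ∀ {F} → IsFacet Δ F → MaximalInΓ Δ κ (colorMultiset κ F)
  facet⇒maximal {F} F-facet = (F , proj₁ F-facet , λ _ → refl) , maximal
    where
    maximal : ∀ M → InΓ Δ κ M → colorMultiset κ F ⊆ₘ M → M ⊆ₘ colorMultiset κ F
    maximal M (S , S-face , S≗M) Fκ⊆M with extendToFacet S-face
    ... | G , G-facet , S⊆G = λ t → begin
      M t                 ≡⟨ S≗M t ⟨
      colorMultiset κ S t ≤⟨ colorMultiset-mono S⊆G t ⟩
      colorMultiset κ G t ≤⟨ colorMultiset-mono G⊆F t ⟩
      colorMultiset κ F t ∎
      where
      open ≤-Reasoning
      Fκ⊆Gκ : colorMultiset κ F ⊆ₘ colorMultiset κ G
      Fκ⊆Gκ t = ≤-trans (Fκ⊆M t) (subst (_≤ colorMultiset κ G t) (S≗M t) (colorMultiset-mono S⊆G t))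
      G⊆F : G ⊆ₛ F
      G⊆F = proj₂ F-facet G (proj₁ G-facet) (λ v Fv → facet-chain F-facet G-facet (Fκ⊆Gκ (κ v)) Fv)

  maximal⇒facet : ∀ {M} → MaximalInΓ Δ κ M → ∃[ F ] IsFacet Δ F × (∀ t → M t ≡ colorMultiset κ F t)
  maximal⇒facet {M} ((S , S-face , S≗M) , M-max) with extendToFacet S-face
  ... | F , F-facet , S⊆F = F , F-facet , λ t → ≤-antisym (M⊆Fκ t) (Fκ⊆M t)
    where
    M⊆Fκ : M ⊆ₘ colorMultiset κ F
    M⊆Fκ t = subst (_≤ colorMultiset κ F t) (S≗M t) (colorMultiset-mono S⊆F t)
    Fκ⊆M : colorMultiset κ F ⊆ₘ M
    Fκ⊆M = M-max (colorMultiset κ F) (F , proj₁ F-facet , λ _ → refl) M⊆Fκ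

  face⇒≤nΓ : ∀ {S} i → face Δ S → colorMultiset κ S i ≤ nΓ Δ face? κ i
  face⇒≤nΓ {S} i S-face = ≤-maximum (allSubsets n) (Any.map S′-bound (allSubsets-complete n S))
    where
    S′-bound : ∀ {S′} → S′ ≐ S → colorMultiset κ S i ≤ (if ⌊ face? S′ ⌋ then colorMultiset κ S′ i else 0)
    S′-bound {S′} S′≐S with face? S′
    ... | yes _          = ≤-reflexive (card-cong (λ v → cong (_∧ ⌊ κ v ≟ i ⌋) (sym (S′≐S v))))
    ... | no  ¬S′-face = contradiction (face-resp-≐ (λ v → sym (S′≐S v)) S-face) ¬S′-face

  nΓ-attained : ∀ i → 0 < nΓ Δ face? κ i → ∃[ S ] face Δ S × colorMultiset κ S i ≡ nΓ Δ face? κ i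
  nΓ-attained i 0<nΓ with maximum-attained (allSubsets n) 0<nΓ
  ... | S , S-attains with face? S
  ...   | yes S-face = S , S-face , S-attains
  ...   | no  _      = contradiction S-attains (<⇒≢ 0<nΓ)

  0<nΓ : ∀ i → 0 < nΓ Δ face? κ i
  0<nΓ i with proj₁ κ-linear i
  ... | u , κu≡i with vertex-in-facet u
  ...   | G , G-facet , Gu = ≤-trans (card-∋⇒positive u u∈Gᵢ) (face⇒≤nΓ i (proj₁ G-facet))
    where
    u∈Gᵢ : (G ∩ₛ κ⁻¹ i) u ≡ true
    u∈Gᵢ = ∧-true Gu (fromWitness≡ (κ u ≟ i) (κu≡i refl))

  colorClass⊆facet : ∀ i → ∃[ F ] IsFacet Δ F × κ⁻¹ i ⊆ₛ F
  colorClass⊆facet i with nΓ-attained i (0<nΓ i)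
  ... | S , S-face , Sᵢ≡nΓ with extendToFacet S-face
  ...   | F , F-facet , S⊆F = F , F-facet , class⊆F
    where
    class⊆F : κ⁻¹ i ⊆ₛ F
    class⊆F v v∈ with vertex-in-facet v | toWitness≡ (κ v ≟ i) v∈
    ... | H , H-facet , Hv | refl = facet-chain H-facet F-facet Hᵢ≤Fᵢ Hv
      where
      Hᵢ≤Fᵢ : colorMultiset κ H i ≤ colorMultiset κ F i
      Hᵢ≤Fᵢ = ≤-trans (face⇒≤nΓ i (proj₁ H-facet))
                      (≤-trans (≤-reflexive (sym Sᵢ≡nΓ)) (colorMultiset-mono S⊆F i))

  nΓ≡classSize : ∀ i → nΓ Δ face? κ i ≡ classSize i
  nΓ≡classSize i with colorClass⊆facet i
  ... | F , F-facet , class⊆F = ≤-antisym (maximum-lub (allSubsets n) bounded) classSize≤nΓ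
    where
    bounded : ∀ S → (if ⌊ face? S ⌋ then colorMultiset κ S i else 0) ≤ classSize i
    bounded S with face? S
    ... | yes _ = card-mono (∩-⊆ʳ {S = S})
    ... | no  _ = z≤n
    classSize≤nΓ : classSize i ≤ nΓ Δ face? κ i
    classSize≤nΓ = ≤-trans (card-mono (λ v v∈ → ∧-true (class⊆F v v∈) v∈)) (face⇒≤nΓ i (proj₁ F-facet))

  pos-onto : ∀ {i r} → r < classSize i → ∃[ v ] κ v ≡ i × pos v ≡ r
  pos-onto {i} r<classSize =
    let v , v∈ , pos-v≡r = injective⇒onto {A = κ⁻¹ i} pos injective bounded ≤-refl r<classSize
    in  v , κ≡i v∈ , pos-v≡r
    where
    κ≡i : ∀ {v} → κ⁻¹ i v ≡ true → κ v ≡ i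
    κ≡i {v} = toWitness≡ (κ v ≟ i)
    injective : ∀ v w → κ⁻¹ i v ≡ true → κ⁻¹ i w ≡ true → pos v ≡ pos w → v ≡ w
    injective v w v∈ w∈ = pos-injective (trans (κ≡i v∈) (sym (κ≡i w∈)))
    bounded : ∀ v → κ⁻¹ i v ≡ true → pos v < classSize i
    bounded v v∈ = subst (λ t → pos v < classSize t) (κ≡i v∈) (pos<classSize v)

  VertexΓ : Set
  VertexΓ = VertΓ Δ face? κ

  pos<nΓ : ∀ v → pos v < nΓ Δ face? κ (κ v)
  pos<nΓ v = subst (pos v <_) (sym (nΓ≡classSize (κ v))) (pos<classSize v)

  toVertexΓ : Fin n → VertexΓ
  toVertexΓ v = κ v , fromℕ< (pos<nΓ v)

  -- Opaque because only the specification of this witness is used; unfolding the search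
  -- behind it makes type checking intractable.
  opaque
    vertexWithLabel : ∀ i (r : Fin (nΓ Δ face? κ i)) → ∃[ v ] κ v ≡ i × pos v ≡ toℕ r
    vertexWithLabel i r = pos-onto (subst (toℕ r <_) (nΓ≡classSize i) (toℕ<n r))

  fromVertexΓ : VertexΓ → Fin n
  fromVertexΓ (i , r) = proj₁ (vertexWithLabel i r)

  VertexΓ-≡ : ∀ {i j} (r : Fin (nΓ Δ face? κ i)) (s : Fin (nΓ Δ face? κ j)) →
              i ≡ j → toℕ r ≡ toℕ s → _≡_ {A = VertexΓ} (i , r) (j , s)
  VertexΓ-≡ r s refl r≡s = cong (_ ,_) (toℕ-injective r≡s)

  κ-fromVertexΓ : ∀ i r → κ (fromVertexΓ (i , r)) ≡ i
  κ-fromVertexΓ i r = proj₁ (proj₂ (vertexWithLabel i r))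

  pos-fromVertexΓ : ∀ i r → pos (fromVertexΓ (i , r)) ≡ toℕ r
  pos-fromVertexΓ i r = proj₂ (proj₂ (vertexWithLabel i r))

  toVertexΓ-fromVertexΓ : ∀ x → toVertexΓ (fromVertexΓ x) ≡ x
  toVertexΓ-fromVertexΓ (i , r) =
    VertexΓ-≡ _ r (κ-fromVertexΓ i r) (trans (toℕ-fromℕ< (pos<nΓ _)) (pos-fromVertexΓ i r))

  fromVertexΓ-toVertexΓ : ∀ v → fromVertexΓ (toVertexΓ v) ≡ v
  fromVertexΓ-toVertexΓ v =
    pos-injective (κ-fromVertexΓ (κ v) r) (trans (pos-fromVertexΓ (κ v) r) (toℕ-fromℕ< (pos<nΓ v)))
    where
    r : Fin (nΓ Δ face? κ (κ v))
    r = fromℕ< (pos<nΓ v)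

  vertexBijection : VertexΓ ↔ Fin n
  vertexBijection = mk↔ₛ′ fromVertexΓ toVertexΓ fromVertexΓ-toVertexΓ toVertexΓ-fromVertexΓ

  face⇒faceΓ : ∀ T → face Δ T → face (ΔΓ Δ face? κ) (T ∘ fromVertexΓ)
  face⇒faceΓ T T-face with extendToFacet T-face
  ... | F , F-facet , T⊆F = colorMultiset κ F , facet⇒maximal F-facet , T∘from⊆S[Fκ]
    where
    T∘from⊆S[Fκ] : (T ∘ fromVertexΓ) ⊆ₛ S[_] {Δ = Δ} {face?} {κ} (colorMultiset κ F)
    T∘from⊆S[Fκ] (i , r) Tv with vertexWithLabel i r
    ... | v , refl , pos-v≡r = fromWitness≡ (suc (toℕ r) ℕ.≤? colorMultiset κ F (κ v))
                                  (subst (λ p → suc p ≤ colorMultiset κ F (κ v)) pos-v≡r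
                                     (∈facet⇒pos< F-facet (T⊆F v Tv)))

  faceΓ⇒face : ∀ T → face (ΔΓ Δ face? κ) (T ∘ fromVertexΓ) → face Δ T
  faceΓ⇒face T (M , M-maximal , T∘from⊆S[M]) with maximal⇒facet M-maximal
  ... | F , F-facet , M≗Fκ = down-closed Δ T⊆F (proj₁ F-facet)
    where
    T⊆F : T ⊆ₛ F
    T⊆F v Tv = pos<⇒∈facet F-facet
                 (subst₂ (λ p m → suc p ≤ m) (toℕ-fromℕ< (pos<nΓ v)) (M≗Fκ (κ v)) label≤M)
      where
      label≤M : suc (toℕ (fromℕ< (pos<nΓ v))) ≤ M (κ v)
      label≤M = toWitness≡ (suc (toℕ (fromℕ< (pos<nΓ v))) ℕ.≤? M (κ v))
                  (T∘from⊆S[M] (toVertexΓ v) (trans (cong T (fromVertexΓ-toVertexΓ v)) Tv))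

theorem3p6 : (n k : ℕ) (Δ : SimplicialComplex (Fin n)) (face? : ∀ S → Dec (face Δ S))
    → IsOnVertexSet Δ → (κ : Fin n → Fin k) → IsLinearColoring k Δ κ
    → ΔΓ Δ face? κ ≅ Δ
theorem3p6 n k Δ face? singletons-are-faces κ κ-linear =
  vertexBijection , λ T → face⇒faceΓ T , faceΓ⇒face T
  where open LinearColoring Δ face? singletons-are-faces κ κ-linear
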